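{- Over data words and over data $\omega$-words, the modalities $\mathtt F^{\not\sim}$ and $\mathtt P^{\not\sim}$ (and hence their duals $\mathtt G^{\not\sim}\varphi:=\neg\mathtt F^{\not\sim}\neg\varphi$ and $\mathtt H^{\not\sim}\varphi:=\neg\mathtt P^{\not\sim}\neg\varphi$) are definable in DLTL: for every DLTL formula $\varphi$, the formulas $\mathtt F^{\not\sim}\varphi$ and $\mathtt P^{\not\sim}\varphi$ are equivalent to DLTL formulas.
   Context: Data words / data $\omega$-words: finite / infinite sequences over $\Sigma\times\mathcal D$ ($\Sigma$ finite, $\mathcal D$ infinite), positions $1,2,\dots$; $i\sim j$ iff positions $i,j$ carry the same data value; class successor/predecessor of $i$: least $j>i$ / greatest $j<i$ with $j\sim i$. DLTL formulas: $\varphi::= a\ (a\in\Sigma)\mid\mathsf S\mid\mathsf P\mid \mathsf M\varphi\ (\mathsf M\in\{\mathtt X^g,\mathtt Y^g,\mathtt X^c,\mathtt Y^c\})\mid\varphi\wedge\varphi\mid\neg\varphi\mid\varphi\,\mathtt U^g\,\varphi\mid\varphi\,\mathtt S^g\,\varphi\mid\varphi\,\mathtt U^c\,\varphi\mid\varphi\,\mathtt S^c\,\varphi$, evaluated at positions $i$: $a$ iff $i$ is labelled $a$; $\mathsf S$ iff $i$ is not last and $i+1$ is the class successor of $i$; $\mathsf P$ iff $i\ne1$ and $i-1$ is the class predecessor of $i$; $\mathtt X^g,\mathtt Y^g,\mathtt X^c,\mathtt Y^c$: the successor, predecessor, class successor, class predecessor exists and satisfies the argument; $\varphi\,\mathtt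 U^g\,\psi$ iff some $j\ge i$ satisfies $\psi$ and all $k$ with $i\le k<j$ satisfy $\varphi$; $\varphi\,\mathtt U^c\,\psi$ iff some $j\ge i$ with $j\sim i$ satisfies $\psi$ and all $k\sim i$ with $i\le k<j$ satisfy $\varphi$; $\mathtt S^g,\mathtt S^c$ are the past mirror images ($j\le i$, $j<k\le i$). Equivalence: holding at the same positions of every data word and data $\omega$-word. $w,i\models\mathtt F^{\not\sim}\varphi$ iff there is $j>i$ with $i\not\sim j$ and $w,j\models\varphi$; $w,i\models\mathtt P^{\not\sim}\varphi$ iff there is $j<i$ with $i\not\sim j$ and $w,j\models\varphi$. -}

module Defs where

open import Level using (0ℓ)
open import Data.Nat using (ℕ; zero; suc; _≤_; _<_)
open import Data.Fin using (Fin)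
open import Data.Unit using (⊤)
open import Data.Empty using (⊥)
open import Data.Product using (Σ; _×_; ∃)
open import Relation.Nullary using (¬_)
open import Relation.Binary.PropositionalEquality using (_≡_; _≢_)
open import Function.Definitions using (Injective)
open import Function.Bundles using (_⇔_)

-- Σ = Fin n  (a finite alphabet); D an arbitrary data domain (assumed infinite in the theorem).

data Length : Set where
  fin   : ℕ → Length
  omega : Length

-- Positions are numbered 0,1,2,... (paper: 1,2,3,...); InDom ℓ i : i is a position.
InDom : Length → ℕ → Set
InDom (fin L) i = i < L
InDom omega   i = ⊤

-- A data word (len = fin L) or data ω-word (len = omega) over Fin n × D.
-- Values of lab/dat outside the domain are irrelevant (never inspected by the semantics).
record DWord (n : ℕ) (D : Set) : Set where
  constructor mkWord
  field
    len : Length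
    lab : ℕ → Fin n
    dat : ℕ → D
open DWord public

_⊢_∼_ : ∀ {n D} → DWord n D → ℕ → ℕ → Set
w ⊢ i ∼ j = dat w i ≡ dat w j

ClassSucc : ∀ {n D} → DWord n D → ℕ → ℕ → Set
ClassSucc w i j = (i < j) × InDom (len w) j × (w ⊢ j ∼ i)
                  × (∀ k → i < k → k < j → ¬ (w ⊢ k ∼ i))

ClassPred : ∀ {n D} → DWord n D → ℕ → ℕ → Set
ClassPred w i j = (j < i) × (w ⊢ j ∼ i)
                  × (∀ k → j < k → k < i → ¬ (w ⊢ k ∼ i))

data Form (n : ℕ) : Set where
  atom : Fin n → Form n
  S P  : Form n
  Xg Yg Xc Yc : Form n → Form n
  _∧_  : Form n → Form n → Form n
  ¬f   : Form n → Form n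
  _Ug_ _Sg_ _Uc_ _Sc_ : Form n → Form n → Form n

-- Satisfaction w , i ⊨ φ  (meaningful for positions i, i.e. InDom (len w) i)
_,_⊨_ : ∀ {n D} → DWord n D → ℕ → Form n → Set
w , i ⊨ atom a = lab w i ≡ a
w , i ⊨ S = ClassSucc w i (suc i)
w , zero  ⊨ P = ⊥
w , suc p ⊨ P = ClassPred w (suc p) p
w , i ⊨ Xg φ = InDom (len w) (suc i) × (w , suc i ⊨ φ)
w , zero  ⊨ Yg φ = ⊥
w , suc p ⊨ Yg φ = w , p ⊨ φ
w , i ⊨ Xc φ = ∃ λ j → ClassSucc w i j × (w , j ⊨ φ)
w , i ⊨ Yc φ = ∃ λ j → ClassPred w i j × (w , j ⊨ φ)
w , i ⊨ (φ ∧ ψ) = (w , i ⊨ φ) × (w , i ⊨ ψ)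
w , i ⊨ ¬f φ = ¬ (w , i ⊨ φ)
w , i ⊨ (φ Ug ψ) = ∃ λ j → (i ≤ j) × InDom (len w) j × (w , j ⊨ ψ)
                    × (∀ k → i ≤ k → k < j → w , k ⊨ φ)
w , i ⊨ (φ Sg ψ) = ∃ λ j → (j ≤ i) × (w , j ⊨ ψ)
                    × (∀ k → j < k → k ≤ i → w , k ⊨ φ)
w , i ⊨ (φ Uc ψ) = ∃ λ j → (i ≤ j) × InDom (len w) j × (w ⊢ j ∼ i) × (w , j ⊨ ψ)
                    × (∀ k → w ⊢ k ∼ i → i ≤ k → k < j → w , k ⊨ φ)
w , i ⊨ (φ Sc ψ) = ∃ λ j → (j ≤ i) × (w ⊢ j ∼ i) × (w , j ⊨ ψ)
                    × (∀ k → w ⊢ k ∼ i → j < k → k ≤ i → w , k ⊨ φ)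

Fneq : ∀ {n D} → Form n → DWord n D → ℕ → Set
Fneq φ w i = ∃ λ j → (i < j) × InDom (len w) j × ¬ (w ⊢ i ∼ j) × (w , j ⊨ φ)

Pneq : ∀ {n D} → Form n → DWord n D → ℕ → Set
Pneq φ w i = ∃ λ j → (j < i) × ¬ (w ⊢ i ∼ j) × (w , j ⊨ φ)

EquivTo : ∀ {n} (D : Set) → Form n → (DWord n D → ℕ → Set) → Set
EquivTo {n} D ψ Q = (w : DWord n D) (i : ℕ) → InDom (len w) i → (w , i ⊨ ψ) ⇔ Q w i

Infinite : Set → Set
Infinite D = Σ (ℕ → D) (Injective _≡_ _≡_)

module Submission where

-- The idea is a marker argument.  Call a set of positions L a marker set if it
-- contains at most one position of every class.  Then "some L-position of a
-- window lies outside the class of i" holds iff the window contains two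
-- L-positions (they lie in different classes, so one of them avoids i's class),
-- or it contains one but none in the class of i (avoid⇔).  For the windows
-- "strictly before", "strictly after" and "everywhere" these three conditions
-- are DLTL-expressible (IsWindow), so Avoiding W L defines the avoidance
-- property (avoiding-⇔).
--
-- P^≁ φ: a witness can be replaced by the class-first φ-position (FirstF φ).
-- F^≁ φ: a witness j either has a class-last φ-position e ≥ j (LastF φ), or its
-- class carries φ infinitely often (Inf φ); then the first position of the
-- class satisfying Inf φ is a marker anywhere in the word, and recurrence of φ
-- supplies a φ-position after i (Fneq-split).

open import Defs
open import Level using (0ℓ)
open import Data.Nat using (ℕ; zero; suc; _≤_; _<_; z≤n; s≤s; _≤?_)
open import Data.Nat.Properties
open import Data.Product using (_×_; ∃; ∃₂; _,_; proj₂)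
open import Data.Sum using (_⊎_; inj₁; inj₂)
open import Data.Empty using (⊥-elim)
open import Relation.Nullary using (¬_; yes; no)
open import Relation.Binary.PropositionalEquality using (_≡_; refl; sym; trans)
open import Relation.Binary using (tri<; tri≈; tri>)
open import Function.Bundles using (_⇔_; mk⇔; Equivalence)
import Function.Properties.Equivalence as ⇔
open import Data.Sum.Function.Propositional using (_⊎-⇔_)
open import Data.Product.Function.NonDependent.Propositional using (_×-⇔_)
open import Axiom.ExcludedMiddle using (ExcludedMiddle)
open import Axiom.DoubleNegationElimination using (em⇒dne)

open Equivalence using (to; from)

inDom-≤ : ∀ ℓ {a b} → a ≤ b → InDom ℓ b → InDom ℓ a
inDom-≤ (fin L) a≤b b<L = ≤-<-trans a≤b b<L
inDom-≤ omega   _   _   = _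

TwoIn : (In L : ℕ → Set) → Set
TwoIn In L = ∃₂ λ a b → a < b × In a × In b × L a × L b

module Formulas {n : ℕ} where

  ⊤f : Form n
  ⊤f = ¬f (S ∧ ¬f S)

  _∨f_ : Form n → Form n → Form n
  α ∨f β = ¬f (¬f α ∧ ¬f β)

  Fs Ps : Form n → Form n
  Fs α = Xg (⊤f Ug α)
  Ps α = Yg (⊤f Sg α)

  XF YP : Form n → Form n
  XF α = Xc (⊤f Uc α)
  YP α = Yc (⊤f Sc α)

  Glob Cls : Form n → Form n
  Glob α = (⊤f Sg α) ∨f (⊤f Ug α)
  Cls α  = (⊤f Sc α) ∨f (⊤f Uc α)

  FirstF LastF : Form n → Form n
  FirstF α = α ∧ ¬f (YP α)
  LastF α  = α ∧ ¬f (XF α)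

  -- from here on, the class of the current position carries φ infinitely often
  Inf : Form n → Form n
  Inf φ = ¬f (⊤f Uc ¬f (XF φ))

  record Window : Set where
    field
      some two inClass : Form n → Form n

  before after everywhere : Window
  before     = record { some = Ps ; two = λ α → Ps (α ∧ Ps α) ; inClass = YP }
  after      = record { some = Fs ; two = λ α → Fs (α ∧ Fs α) ; inClass = XF }
  everywhere = record { some = Glob ; two = λ α → Glob (α ∧ Ps α) ; inClass = Cls }

  Avoiding : Window → Form n → Form n
  Avoiding W L = two L ∨f (some L ∧ ¬f (inClass L))
    where open Window W

  FutureNeq PastNeq : Form n → Form n
  FutureNeq φ = Avoiding after (LastF φ) ∨f Avoiding everywhere (FirstF (Inf φ))
  PastNeq φ   = Avoiding before (FirstF φ)

module Classical (em : ExcludedMiddle 0ℓ) where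

  private
    leastBelow : (Q : ℕ → Set) → ∀ b {m} → m < b → Q m →
                 ∃ λ k → Q k × (∀ k' → k' < k → ¬ Q k')
    leastBelow Q (suc b) {m} m<sb qm with em {∃ λ m' → m' < b × Q m'}
    ... | yes (_ , m'<b , qm') = leastBelow Q b m'<b qm'
    ... | no none = m , qm , λ k' k'<m qk' → none (k' , <-≤-trans k'<m (≤-pred m<sb) , qk')

  least : (Q : ℕ → Set) → ∀ {m} → Q m → ∃ λ k → k ≤ m × Q k × (∀ k' → k' < k → ¬ Q k')
  least Q {m} qm with leastBelow Q (suc m) ≤-refl qm
  ... | k , qk , min = k , ≮⇒≥ (λ m<k → min m m<k qm) , qk , min

  greatestBelow : (Q : ℕ → Set) → ∀ b {m} → m < b → Q m →
                  ∃ λ k → m ≤ k × k < b × Q k × (∀ k' → k < k' → k' < b → ¬ Q k')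
  greatestBelow Q (suc b) {m} m<sb qm with em {Q b}
  ... | yes qb = b , ≤-pred m<sb , ≤-refl , qb , λ k' b<k' k'<sb _ → <⇒≱ b<k' (≤-pred k'<sb)
  ... | no ¬qb with m≤n⇒m<n∨m≡n (≤-pred m<sb)
  ...   | inj₂ refl = ⊥-elim (¬qb qm)
  ...   | inj₁ m<b with greatestBelow Q b m<b qm
  ...     | k , m≤k , k<b , qk , max = k , m≤k , m<n⇒m<1+n k<b , qk , above
    where
      above : ∀ k' → k < k' → k' < suc b → ¬ Q k'
      above k' k<k' k'<sb with m≤n⇒m<n∨m≡n (≤-pred k'<sb)
      ... | inj₁ k'<b = max k' k<k' k'<b
      ... | inj₂ refl = ¬qb

  avoid⇔ : {D : Set} (f : ℕ → D) (In L : ℕ → Set) →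
           (∀ {a b} → In a → In b → L a → L b → f a ≡ f b → a ≡ b) → (c : D) →
           (∃ λ a → In a × L a × ¬ f a ≡ c)
             ⇔ (TwoIn In L ⊎ ((∃ λ a → In a × L a) × ¬ (∃ λ a → In a × f a ≡ c × L a)))
  avoid⇔ f In L unique c = mk⇔ split join
    where
      split : (∃ λ a → In a × L a × ¬ f a ≡ c) →
              TwoIn In L ⊎ ((∃ λ a → In a × L a) × ¬ (∃ λ a → In a × f a ≡ c × L a))
      split (a , ia , la , a≁c) with em {∃ λ d → In d × f d ≡ c × L d}
      ... | no none = inj₂ ((a , ia , la) , none)
      ... | yes (d , id , d∼c , ld) with <-cmp a d
      ...   | tri< a<d _ _ = inj₁ (a , d , a<d , ia , id , la , ld)
      ...   | tri≈ _ refl _ = ⊥-elim (a≁c d∼c)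
      ...   | tri> _ _ d<a = inj₁ (d , a , d<a , id , ia , ld , la)

      -- of two distinct markers at most one has colour c
      join : TwoIn In L ⊎ ((∃ λ a → In a × L a) × ¬ (∃ λ a → In a × f a ≡ c × L a)) →
             ∃ λ a → In a × L a × ¬ f a ≡ c
      join (inj₁ (a , b , a<b , ia , ib , la , lb)) with em {f a ≡ c}
      ... | yes a∼c = b , ib , lb , λ b∼c → <⇒≢ a<b (unique ia ib la lb (trans a∼c (sym b∼c)))
      ... | no a≁c  = a , ia , la , a≁c
      join (inj₂ ((a , ia , la) , none)) = a , ia , la , λ a∼c → none (a , ia , a∼c , la)

open Formulas

module Semantics (em : ExcludedMiddle 0ℓ) {n : ℕ} {D : Set} (w : DWord n D) where

  open Classical em

  -- Excluded middle is needed for the disjunctions and negations of DLTL.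
  dne : {A : Set} → ¬ ¬ A → A
  dne = em⇒dne em

  Dom : ℕ → Set
  Dom = InDom (len w)

  _∼_ : ℕ → ℕ → Set
  a ∼ b = w ⊢ a ∼ b

  ⟦_⟧ : Form n → ℕ → Set
  ⟦ α ⟧ i = w , i ⊨ α

  ¬-⇔ : {A B : Set} → A ⇔ B → (¬ A) ⇔ (¬ B)
  ¬-⇔ A⇔B = mk⇔ (λ ¬a b → ¬a (from A⇔B b)) (λ ¬b a → ¬b (to A⇔B a))

  ⊤-holds : ∀ {i} → ⟦ ⊤f ⟧ i
  ⊤-holds (s , ¬s) = ¬s s

  ∨-⇔ : ∀ α β {i} → ⟦ α ∨f β ⟧ i ⇔ (⟦ α ⟧ i ⊎ ⟦ β ⟧ i)
  ∨-⇔ α β {i} = mk⇔ cases (λ { (inj₁ a) (¬a , _) → ¬a a ; (inj₂ b) (_ , ¬b) → ¬b b })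
    where
      cases : ⟦ α ∨f β ⟧ i → ⟦ α ⟧ i ⊎ ⟦ β ⟧ i
      cases h with em {⟦ α ⟧ i}
      ... | yes a = inj₁ a
      ... | no ¬a = inj₂ (dne (λ ¬b → h (¬a , ¬b)))

  Fs-⇔ : ∀ α {i} → ⟦ Fs α ⟧ i ⇔ (∃ λ a → (i < a × Dom a) × ⟦ α ⟧ a)
  Fs-⇔ _ = mk⇔ (λ (_ , a , i<a , Da , αa , _) → a , (i<a , Da) , αa)
              (λ (a , (i<a , Da) , αa) → inDom-≤ (len w) i<a Da , a , i<a , Da , αa , λ _ _ _ → ⊤-holds)

  Ps-⇔ : ∀ α {i} → ⟦ Ps α ⟧ i ⇔ (∃ λ a → a < i × ⟦ α ⟧ a)
  Ps-⇔ _ {zero}  = mk⇔ (λ ()) (λ { (_ , () , _) })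
  Ps-⇔ _ {suc p} = mk⇔ (λ (a , a≤p , αa , _) → a , s≤s a≤p , αa)
                         (λ { (a , s≤s a≤p , αa) → a , a≤p , αa , λ _ _ _ → ⊤-holds })

  -- The class successor is found by the least number principle.
  XF-⇔ : ∀ α {i} → ⟦ XF α ⟧ i ⇔ (∃ λ a → (i < a × Dom a) × a ∼ i × ⟦ α ⟧ a)
  XF-⇔ α {i} = mk⇔ (λ (j , (i<j , _ , j∼i , _) , a , j≤a , Da , a∼j , αa , _) →
                         a , (<-≤-trans i<j j≤a , Da) , trans a∼j j∼i , αa)
                      intro
    where
      intro : (∃ λ a → (i < a × Dom a) × a ∼ i × ⟦ α ⟧ a) → ⟦ XF α ⟧ i
      intro (a , ia , a∼i , αa) with least (λ k → (i < k × Dom k) × k ∼ i) (ia , a∼i)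
      ... | j , j≤a , ((i<j , Dj) , j∼i) , min =
        j , (i<j , Dj , j∼i , λ k i<k k<j k∼i → min k k<j ((i<k , inDom-≤ (len w) (<⇒≤ k<j) Dj) , k∼i)) ,
        a , j≤a , proj₂ ia , trans a∼i (sym j∼i) , αa , λ _ _ _ _ → ⊤-holds

  -- The class predecessor is the greatest class-mate below i.
  YP-⇔ : ∀ α {i} → ⟦ YP α ⟧ i ⇔ (∃ λ a → a < i × a ∼ i × ⟦ α ⟧ a)
  YP-⇔ α {i} = mk⇔ (λ (j , (j<i , j∼i , _) , a , a≤j , a∼j , αa , _) →
                         a , ≤-<-trans a≤j j<i , trans a∼j j∼i , αa)
                      intro
    where
      intro : (∃ λ a → a < i × a ∼ i × ⟦ α ⟧ a) → ⟦ YP α ⟧ i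
      intro (a , a<i , a∼i , αa) with greatestBelow (_∼ i) i a<i a∼i
      ... | j , a≤j , j<i , j∼i , max =
        j , (j<i , j∼i , max) , a , a≤j , trans a∼i (sym j∼i) , αa , λ _ _ _ _ → ⊤-holds

  Glob-⇔ : ∀ α {i} → Dom i → ⟦ Glob α ⟧ i ⇔ (∃ λ a → Dom a × ⟦ α ⟧ a)
  Glob-⇔ α {i} Di = mk⇔ elim (λ h → from (∨-⇔ (⊤f Sg α) (⊤f Ug α)) (intro h))
    where
      elim : ⟦ Glob α ⟧ i → ∃ λ a → Dom a × ⟦ α ⟧ a
      elim h with to (∨-⇔ (⊤f Sg α) (⊤f Ug α)) h
      ... | inj₁ (a , a≤i , αa , _)   = a , inDom-≤ (len w) a≤i Di , αa
      ... | inj₂ (a , _ , Da , αa , _) = a , Da , αa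
      intro : (∃ λ a → Dom a × ⟦ α ⟧ a) → ⟦ ⊤f Sg α ⟧ i ⊎ ⟦ ⊤f Ug α ⟧ i
      intro (a , Da , αa) with a ≤? i
      ... | yes a≤i = inj₁ (a , a≤i , αa , λ _ _ _ → ⊤-holds)
      ... | no a≰i  = inj₂ (a , <⇒≤ (≰⇒> a≰i) , Da , αa , λ _ _ _ → ⊤-holds)

  Cls-⇔ : ∀ α {i} → Dom i → ⟦ Cls α ⟧ i ⇔ (∃ λ a → Dom a × a ∼ i × ⟦ α ⟧ a)
  Cls-⇔ α {i} Di = mk⇔ elim (λ h → from (∨-⇔ (⊤f Sc α) (⊤f Uc α)) (intro h))
    where
      elim : ⟦ Cls α ⟧ i → ∃ λ a → Dom a × a ∼ i × ⟦ α ⟧ a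
      elim h with to (∨-⇔ (⊤f Sc α) (⊤f Uc α)) h
      ... | inj₁ (a , a≤i , a∼i , αa , _)   = a , inDom-≤ (len w) a≤i Di , a∼i , αa
      ... | inj₂ (a , _ , Da , a∼i , αa , _) = a , Da , a∼i , αa
      intro : (∃ λ a → Dom a × a ∼ i × ⟦ α ⟧ a) → ⟦ ⊤f Sc α ⟧ i ⊎ ⟦ ⊤f Uc α ⟧ i
      intro (a , Da , a∼i , αa) with a ≤? i
      ... | yes a≤i = inj₁ (a , a≤i , a∼i , αa , λ _ _ _ _ → ⊤-holds)
      ... | no a≰i  = inj₂ (a , <⇒≤ (≰⇒> a≰i) , Da , a∼i , αa , λ _ _ _ _ → ⊤-holds)

  record IsWindow (W : Window {n}) (In : ℕ → ℕ → Set) : Set where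
    field
      some-⇔    : ∀ α {i} → Dom i → ⟦ Window.some W α ⟧ i ⇔ (∃ λ a → In i a × ⟦ α ⟧ a)
      two-⇔     : ∀ α {i} → Dom i → ⟦ Window.two W α ⟧ i ⇔ TwoIn (In i) ⟦ α ⟧
      inClass-⇔ : ∀ α {i} → Dom i → ⟦ Window.inClass W α ⟧ i ⇔ (∃ λ a → In i a × a ∼ i × ⟦ α ⟧ a)

  before-isWindow : IsWindow before (λ i a → a < i)
  before-isWindow = record { some-⇔ = λ α _ → Ps-⇔ α ; two-⇔ = λ α _ → two α ; inClass-⇔ = λ α _ → YP-⇔ α }
    where
      two : ∀ α {i} → ⟦ Ps (α ∧ Ps α) ⟧ i ⇔ TwoIn (_< i) ⟦ α ⟧
      two α = mk⇔
        (λ h → let (b , b<i , αb , pb) = to (Ps-⇔ (α ∧ Ps α)) h ; (a , a<b , αa) = to (Ps-⇔ α) pb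
               in a , b , a<b , <-trans a<b b<i , b<i , αa , αb)
        (λ (a , b , a<b , _ , b<i , αa , αb) →
           from (Ps-⇔ (α ∧ Ps α)) (b , b<i , αb , from (Ps-⇔ α) (a , a<b , αa)))

  after-isWindow : IsWindow after (λ i a → i < a × Dom a)
  after-isWindow = record { some-⇔ = λ α _ → Fs-⇔ α ; two-⇔ = λ α _ → two α ; inClass-⇔ = λ α _ → XF-⇔ α }
    where
      two : ∀ α {i} → ⟦ Fs (α ∧ Fs α) ⟧ i ⇔ TwoIn (λ a → i < a × Dom a) ⟦ α ⟧
      two α = mk⇔
        (λ h → let (a , (i<a , Da) , αa , fa) = to (Fs-⇔ (α ∧ Fs α)) h ; (b , (a<b , Db) , αb) = to (Fs-⇔ α) fa
               in a , b , a<b , (i<a , Da) , (<-trans i<a a<b , Db) , αa , αb)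
        (λ (a , b , a<b , ia , (_ , Db) , αa , αb) →
           from (Fs-⇔ (α ∧ Fs α)) (a , ia , αa , from (Fs-⇔ α) (b , (a<b , Db) , αb)))

  everywhere-isWindow : IsWindow everywhere (λ _ a → Dom a)
  everywhere-isWindow = record { some-⇔ = Glob-⇔ ; two-⇔ = two ; inClass-⇔ = Cls-⇔ }
    where
      two : ∀ α {i} → Dom i → ⟦ Glob (α ∧ Ps α) ⟧ i ⇔ TwoIn Dom ⟦ α ⟧
      two α Di = mk⇔
        (λ h → let (b , Db , αb , pb) = to (Glob-⇔ (α ∧ Ps α) Di) h ; (a , a<b , αa) = to (Ps-⇔ α) pb
               in a , b , a<b , inDom-≤ (len w) (<⇒≤ a<b) Db , Db , αa , αb)
        (λ (a , b , a<b , _ , Db , αa , αb) →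
           from (Glob-⇔ (α ∧ Ps α) Di) (b , Db , αb , from (Ps-⇔ α) (a , a<b , αa)))

  avoiding-⇔ : ∀ {W In} L {i} → IsWindow W In →
               (∀ {a b} → In i a → In i b → ⟦ L ⟧ a → ⟦ L ⟧ b → a ∼ b → a ≡ b) → Dom i →
               ⟦ Avoiding W L ⟧ i ⇔ (∃ λ a → In i a × ⟦ L ⟧ a × ¬ a ∼ i)
  avoiding-⇔ {W} {In} L {i} isW unique Di =
    ⇔.trans (∨-⇔ (Window.two W L) (Window.some W L ∧ ¬f (Window.inClass W L)))
      (⇔.trans (two-⇔ L Di ⊎-⇔ (some-⇔ L Di ×-⇔ ¬-⇔ (inClass-⇔ L Di)))
               (⇔.sym (avoid⇔ (dat w) (In i) ⟦ L ⟧ unique (dat w i))))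
    where open IsWindow isW

  first-unique : ∀ α {a b} → ⟦ FirstF α ⟧ a → ⟦ FirstF α ⟧ b → a ∼ b → a ≡ b
  first-unique α {a} {b} (αa , ¬pa) (αb , ¬pb) a∼b with <-cmp a b
  ... | tri< a<b _ _ = ⊥-elim (¬pb (from (YP-⇔ α) (a , a<b , a∼b , αa)))
  ... | tri≈ _ a≡b _ = a≡b
  ... | tri> _ _ b<a = ⊥-elim (¬pa (from (YP-⇔ α) (b , b<a , sym a∼b , αb)))

  last-unique : ∀ α {a b} → Dom a → Dom b → ⟦ LastF α ⟧ a → ⟦ LastF α ⟧ b → a ∼ b → a ≡ b
  last-unique α {a} {b} Da Db (αa , ¬fa) (αb , ¬fb) a∼b with <-cmp a b
  ... | tri< a<b _ _ = ⊥-elim (¬fa (from (XF-⇔ α) (b , (a<b , Db) , sym a∼b , αb)))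
  ... | tri≈ _ a≡b _ = a≡b
  ... | tri> _ _ b<a = ⊥-elim (¬fb (from (XF-⇔ α) (a , (b<a , Da) , a∼b , αa)))

  first-exists : ∀ α {j} → ⟦ α ⟧ j → ∃ λ e → e ≤ j × e ∼ j × ⟦ FirstF α ⟧ e
  first-exists α {j} αj with least (λ e → e ∼ j × ⟦ α ⟧ e) (refl , αj)
  ... | e , e≤j , (e∼j , αe) , min =
    e , e≤j , e∼j , αe , λ h → let (m , m<e , m∼e , αm) = to (YP-⇔ α) h in min m m<e (trans m∼e e∼j , αm)

  last-exists : ∀ α {j m} → Dom m → j ≤ m → m ∼ j → ¬ ⟦ XF α ⟧ m → ⟦ α ⟧ j →
                ∃ λ e → j ≤ e × Dom e × e ∼ j × ⟦ LastF α ⟧ e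
  last-exists α {j} {m} Dm j≤m m∼j ¬fm αj
    with greatestBelow (λ e → e ∼ j × ⟦ α ⟧ e) (suc m) (s≤s j≤m) (refl , αj)
  ... | e , j≤e , e<sm , (e∼j , αe) , max = e , j≤e , De , e∼j , αe , noLater
    where
      De : Dom e
      De = inDom-≤ (len w) (≤-pred e<sm) Dm
      noLater : ¬ ⟦ XF α ⟧ e
      noLater h with to (XF-⇔ α) h
      ... | r , (e<r , Dr) , r∼e , αr with r ≤? m
      ...   | yes r≤m = max r e<r (s≤s r≤m) (trans r∼e e∼j , αr)
      ...   | no r≰m  = ¬fm (from (XF-⇔ α) (r , (≰⇒> r≰m , Dr) , trans r∼e (trans e∼j (sym m∼j)) , αr))

  Recurrent : Form n → ℕ → Set
  Recurrent φ a = ∀ m → a ≤ m → Dom m → m ∼ a → ⟦ XF φ ⟧ m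

  Inf-⇔ : ∀ φ {a} → ⟦ Inf φ ⟧ a ⇔ Recurrent φ a
  Inf-⇔ _ = mk⇔ (λ h m a≤m Dm m∼a → dne (λ ¬fm → h (m , a≤m , Dm , m∼a , ¬fm , λ _ _ _ _ → ⊤-holds)))
              (λ R (m , a≤m , Dm , m∼a , ¬fm , _) → ¬fm (R m a≤m Dm m∼a))

  recurrent-unbounded : ∀ φ {a} → Dom a → Recurrent φ a → ∀ t →
                        ∃ λ r → t < r × Dom r × r ∼ a × ⟦ φ ⟧ r
  recurrent-unbounded φ {a} Da R t =
    let (r , (t<r , _) , found) = beyond t in r , t<r , found
    where
      beyond : ∀ t → ∃ λ r → (t < r × a ≤ r) × Dom r × r ∼ a × ⟦ φ ⟧ r
      beyond zero with to (XF-⇔ φ) (R a ≤-refl Da refl)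
      ... | r , (a<r , Dr) , r∼a , φr = r , (≤-<-trans z≤n a<r , <⇒≤ a<r) , Dr , r∼a , φr
      beyond (suc t) with beyond t
      ... | r , (t<r , a≤r) , Dr , r∼a , _ with to (XF-⇔ φ) (R r a≤r Dr r∼a)
      ...   | r' , (r<r' , Dr') , r'∼r , φr' =
        r' , (≤-<-trans t<r r<r' , ≤-trans a≤r (<⇒≤ r<r')) , Dr' , trans r'∼r r∼a , φr'

  nonrecurrent⇒last : ∀ φ {j} → ¬ Recurrent φ j → ⟦ φ ⟧ j →
                      ∃ λ e → j ≤ e × Dom e × e ∼ j × ⟦ LastF φ ⟧ e
  nonrecurrent⇒last φ {j} ¬R φj
    with dne (λ (none : ¬ ∃ λ m → j ≤ m × Dom m × m ∼ j × ¬ ⟦ XF φ ⟧ m) →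
                ¬R (λ m j≤m Dm m∼j → dne (λ ¬fm → none (m , j≤m , Dm , m∼j , ¬fm))))
  ... | m , j≤m , Dm , m∼j , ¬fm = last-exists φ Dm j≤m m∼j ¬fm φj

  Pneq-split : ∀ φ {i} → Pneq φ w i ⇔ (∃ λ e → e < i × ⟦ FirstF φ ⟧ e × ¬ e ∼ i)
  Pneq-split φ = mk⇔
    (λ (j , j<i , i≁j , φj) → let (e , e≤j , e∼j , fe) = first-exists φ φj
                               in e , ≤-<-trans e≤j j<i , fe , λ e∼i → i≁j (trans (sym e∼i) e∼j))
    (λ (e , e<i , (φe , _) , e≁i) → e , e<i , (λ i∼e → e≁i (sym i∼e)) , φe)

  Fneq-split : ∀ φ {i} → Fneq φ w i ⇔
               ((∃ λ e → (i < e × Dom e) × ⟦ LastF φ ⟧ e × ¬ e ∼ i)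
                ⊎ (∃ λ q → Dom q × ⟦ FirstF (Inf φ) ⟧ q × ¬ q ∼ i))
  Fneq-split φ {i} = mk⇔ split join
    where
      split : Fneq φ w i → (∃ λ e → (i < e × Dom e) × ⟦ LastF φ ⟧ e × ¬ e ∼ i)
                           ⊎ (∃ λ q → Dom q × ⟦ FirstF (Inf φ) ⟧ q × ¬ q ∼ i)
      split (j , i<j , Dj , i≁j , φj) with em {Recurrent φ j}
      ... | yes R = let (q , q≤j , q∼j , fq) = first-exists (Inf φ) (from (Inf-⇔ φ) R)
                    in inj₂ (q , inDom-≤ (len w) q≤j Dj , fq , λ q∼i → i≁j (trans (sym q∼i) q∼j))
      ... | no ¬R = let (e , j≤e , De , e∼j , le) = nonrecurrent⇒last φ ¬R φj
                    in inj₁ (e , (<-≤-trans i<j j≤e , De) , le , λ e∼i → i≁j (trans (sym e∼i) e∼j))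

      join : (∃ λ e → (i < e × Dom e) × ⟦ LastF φ ⟧ e × ¬ e ∼ i)
             ⊎ (∃ λ q → Dom q × ⟦ FirstF (Inf φ) ⟧ q × ¬ q ∼ i) → Fneq φ w i
      join (inj₁ (e , (i<e , De) , (φe , _) , e≁i)) = e , i<e , De , (λ i∼e → e≁i (sym i∼e)) , φe
      join (inj₂ (q , Dq , (infq , _) , q≁i)) with recurrent-unbounded φ Dq (to (Inf-⇔ φ) infq) i
      ... | r , i<r , Dr , r∼q , φr = r , i<r , Dr , (λ i∼r → q≁i (sym (trans i∼r r∼q))) , φr

  pastNeq-⇔ : ∀ φ {i} → Dom i → ⟦ PastNeq φ ⟧ i ⇔ Pneq φ w i
  pastNeq-⇔ φ Di =
    ⇔.trans (avoiding-⇔ (FirstF φ) before-isWindow (λ _ _ → first-unique φ) Di) (⇔.sym (Pneq-split φ))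

  futureNeq-⇔ : ∀ φ {i} → Dom i → ⟦ FutureNeq φ ⟧ i ⇔ Fneq φ w i
  futureNeq-⇔ φ Di =
    ⇔.trans (∨-⇔ (Avoiding after (LastF φ)) (Avoiding everywhere (FirstF (Inf φ))))
      (⇔.trans (avoiding-⇔ (LastF φ) after-isWindow (λ (_ , Da) (_ , Db) → last-unique φ Da Db) Di
                ⊎-⇔ avoiding-⇔ (FirstF (Inf φ)) everywhere-isWindow (λ _ _ → first-unique (Inf φ)) Di)
               (⇔.sym (Fneq-split φ)))

corollary3 : ExcludedMiddle 0ℓ → {n : ℕ} (D : Set) → Infinite D → (φ : Form n) →
    (∃ λ ψ → EquivTo D ψ (Fneq φ)) × (∃ λ ψ → EquivTo D ψ (Pneq φ))
corollary3 em D _ φ =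
  (FutureNeq φ , λ w _ Di → Semantics.futureNeq-⇔ em w φ Di) ,
  (PastNeq φ   , λ w _ Di → Semantics.pastNeq-⇔ em w φ Di)
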